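{- For every type variable $X$ and types $A,B,C$ such that $\forall X.A\equiv B\wedge C$, there exist types $B',C'$ such that $B\equiv\forall X.B'$, $C\equiv\forall X.C'$ and $A\equiv B'\wedge C'$.
   Context: Types: $A ::= X \mid A\Rightarrow A \mid A\wedge A \mid \forall X.A$, $X$ type variables, modulo $\alpha$-equivalence; $\Rightarrow$ associates to the right. Type isomorphism $\equiv$ is the smallest congruence on types containing: $A\wedge B\equiv B\wedge A$; $A\wedge(B\wedge C)\equiv(A\wedge B)\wedge C$; $A\Rightarrow(B\wedge C)\equiv(A\Rightarrow B)\wedge(A\Rightarrow C)$; $(A\wedge B)\Rightarrow C\equiv A\Rightarrow B\Rightarrow C$; $\forall X.(A\Rightarrow B)\equiv A\Rightarrow\forall X.B$ if $X\notin FTV(A)$; $\forall X.(A\wedge B)\equiv\forall X.A\wedge\forall X.B$. -}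

module Defs where

open import Data.Nat using (ℕ; zero; suc; _<ᵇ_)
open import Data.Bool using (if_then_else_)

-- Types of the system, with type variables as de Bruijn indices
-- (so types are automatically identified up to α-equivalence).
-- `∀' A` binds index 0 in A.
infixr 6 _⇒_
infixr 7 _∧_
data Ty : Set where
  var : ℕ → Ty
  _⇒_ : Ty → Ty → Ty
  _∧_ : Ty → Ty → Ty
  ∀'  : Ty → Ty

shiftFrom : ℕ → Ty → Ty
shiftFrom c (var i) = if i <ᵇ c then var i else var (suc i)
shiftFrom c (A ⇒ B) = shiftFrom c A ⇒ shiftFrom c B
shiftFrom c (A ∧ B) = shiftFrom c A ∧ shiftFrom c B
shiftFrom c (∀' A)  = ∀' (shiftFrom (suc c) A)

-- weakening: move a type under one more binder (its free vars do not
-- refer to the new bound variable, i.e. X ∉ FTV)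
↑ : Ty → Ty
↑ = shiftFrom zero

infix 4 _≅_
data _≅_ : Ty → Ty → Set where
  comm    : ∀ A B → A ∧ B ≅ B ∧ A
  assoc   : ∀ A B C → A ∧ (B ∧ C) ≅ (A ∧ B) ∧ C
  distrib : ∀ A B C → A ⇒ (B ∧ C) ≅ (A ⇒ B) ∧ (A ⇒ C)
  curry   : ∀ A B C → (A ∧ B) ⇒ C ≅ A ⇒ B ⇒ C
  -- ∀X.(A ⇒ B) ≡ A ⇒ ∀X.B when X ∉ FTV(A): in de Bruijn form A is ↑ A₀
  p-split : ∀ A B → ∀' (↑ A ⇒ B) ≅ A ⇒ ∀' B
  p-dist  : ∀ A B → ∀' (A ∧ B) ≅ ∀' A ∧ ∀' B
  refl'   : ∀ A → A ≅ A
  sym'    : ∀ {A B} → A ≅ B → B ≅ A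
  trans'  : ∀ {A B C} → A ≅ B → B ≅ C → A ≅ C
  cong⇒   : ∀ {A A' B B'} → A ≅ A' → B ≅ B' → A ⇒ B ≅ A' ⇒ B'
  cong∧   : ∀ {A A' B B'} → A ≅ A' → B ≅ B' → A ∧ B ≅ A' ∧ B'
  cong∀   : ∀ {A A'} → A ≅ A' → ∀' A ≅ ∀' A'

-- A type T may "expose" a quantifier: T ⇝∀ U when ∀X.U is obtained from T by
-- pulling ∀X out of components of conjunctions and codomains of implications,
-- so T ≅ ∀X.U. Every axiom and congruence rule of ≅ carries such a witness for
-- one side to a witness for the other side whose body is isomorphic. Starting
-- from the trivial witness ∀X.A ⇝∀ A, we get B ∧ C ⇝∀ U with A ≅ U, and a
-- witness for a conjunction is a pair of witnesses B ⇝∀ B', C ⇝∀ C' with U = B' ∧ C'.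
module Submission where

open import Defs
open import Data.Product using (Σ-syntax; _×_; _,_; proj₁; swap)
open import Data.Nat using (ℕ; zero; suc; _+_; _<ᵇ_)
open import Data.Bool using (true; false)
open import Relation.Binary.PropositionalEquality using (_≡_; refl; cong; cong₂)

shiftVar : ℕ → ℕ → ℕ
shiftVar zero    i       = suc i
shiftVar (suc c) zero    = zero
shiftVar (suc c) (suc i) = suc (shiftVar c i)

incrVar : Ty → Ty
incrVar (var j) = var (suc j)
incrVar T       = T

shiftFrom-var : ∀ c i → shiftFrom c (var i) ≡ var (shiftVar c i)
shiftFrom-var zero    i       = refl
shiftFrom-var (suc c) zero    = refl
shiftFrom-var (suc c) (suc i) with i <ᵇ c | shiftFrom-var c i
... | true  | eq = cong incrVar eq
... | false | eq = cong incrVar eq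

shiftVar-comm : ∀ k d i →
  shiftVar (suc (k + d)) (shiftVar k i) ≡ shiftVar k (shiftVar (k + d) i)
shiftVar-comm zero    d i       = refl
shiftVar-comm (suc k) d zero    = refl
shiftVar-comm (suc k) d (suc i) = cong suc (shiftVar-comm k d i)

shiftFrom-comm : ∀ k d A →
  shiftFrom (suc (k + d)) (shiftFrom k A) ≡ shiftFrom k (shiftFrom (k + d) A)
shiftFrom-comm k d (var i)
  rewrite shiftFrom-var k i | shiftFrom-var (k + d) i
        | shiftFrom-var (suc (k + d)) (shiftVar k i)
        | shiftFrom-var k (shiftVar (k + d) i)
  = cong var (shiftVar-comm k d i)
shiftFrom-comm k d (A ⇒ B) = cong₂ _⇒_ (shiftFrom-comm k d A) (shiftFrom-comm k d B)
shiftFrom-comm k d (A ∧ B) = cong₂ _∧_ (shiftFrom-comm k d A) (shiftFrom-comm k d B)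
shiftFrom-comm k d (∀' A)  = cong ∀' (shiftFrom-comm (suc k) d A)

shiftFrom-↑ : ∀ c A → shiftFrom (suc c) (↑ A) ≡ ↑ (shiftFrom c A)
shiftFrom-↑ = shiftFrom-comm zero

shiftFrom-≅ : ∀ c {A B} → A ≅ B → shiftFrom c A ≅ shiftFrom c B
shiftFrom-≅ c (comm A B)      = comm _ _
shiftFrom-≅ c (assoc A B C)   = assoc _ _ _
shiftFrom-≅ c (distrib A B C) = distrib _ _ _
shiftFrom-≅ c (curry A B C)   = curry _ _ _
shiftFrom-≅ c (p-split A B)
  rewrite shiftFrom-↑ c A     = p-split (shiftFrom c A) (shiftFrom (suc c) B)
shiftFrom-≅ c (p-dist A B)    = p-dist _ _
shiftFrom-≅ c (refl' A)       = refl' _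
shiftFrom-≅ c (sym' p)        = sym' (shiftFrom-≅ c p)
shiftFrom-≅ c (trans' p q)    = trans' (shiftFrom-≅ c p) (shiftFrom-≅ c q)
shiftFrom-≅ c (cong⇒ p q)     = cong⇒ (shiftFrom-≅ c p) (shiftFrom-≅ c q)
shiftFrom-≅ c (cong∧ p q)     = cong∧ (shiftFrom-≅ c p) (shiftFrom-≅ c q)
shiftFrom-≅ c (cong∀ p)       = cong∀ (shiftFrom-≅ (suc c) p)

↑-≅ : ∀ {A B} → A ≅ B → ↑ A ≅ ↑ B
↑-≅ = shiftFrom-≅ zero

infix 4 _⇝∀_
data _⇝∀_ : Ty → Ty → Set where
  pull-∀ : ∀ U → ∀' U ⇝∀ U
  pull-∧ : ∀ {B B' C C'} → B ⇝∀ B' → C ⇝∀ C' → B ∧ C ⇝∀ B' ∧ C'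
  pull-⇒ : ∀ A {B B'} → B ⇝∀ B' → A ⇒ B ⇝∀ ↑ A ⇒ B'

⇝∀-sound : ∀ {T U} → T ⇝∀ U → T ≅ ∀' U
⇝∀-sound (pull-∀ U)   = refl' _
⇝∀-sound (pull-∧ p q) = trans' (cong∧ (⇝∀-sound p) (⇝∀-sound q)) (sym' (p-dist _ _))
⇝∀-sound (pull-⇒ A p) = trans' (cong⇒ (refl' A) (⇝∀-sound p)) (sym' (p-split _ _))

Simulates : Ty → Ty → Set
Simulates T T' = ∀ {U} → T ⇝∀ U → Σ[ U' ∈ Ty ] (T' ⇝∀ U' × U ≅ U')

Bisimulates : Ty → Ty → Set
Bisimulates T T' = Simulates T T' × Simulates T' T

simulates-refl : ∀ {T} → Simulates T T
simulates-refl p = _ , p , refl' _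

simulates-trans : ∀ {T T' T''} → Simulates T T' → Simulates T' T'' → Simulates T T''
simulates-trans f g p with f p
... | _ , p' , e with g p'
...   | _ , p'' , e' = _ , p'' , trans' e e'

simulates-∧ : ∀ {B B' C C'} → Simulates B B' → Simulates C C' → Simulates (B ∧ C) (B' ∧ C')
simulates-∧ f g (pull-∧ p q) with f p | g q
... | _ , p' , e | _ , q' , e' = _ , pull-∧ p' q' , cong∧ e e'

simulates-⇒ : ∀ {A A' B B'} → A ≅ A' → Simulates B B' → Simulates (A ⇒ B) (A' ⇒ B')
simulates-⇒ {A' = A'} eA f (pull-⇒ _ p) with f p
... | _ , p' , e = _ , pull-⇒ A' p' , cong⇒ (↑-≅ eA) e

simulates-∀ : ∀ {A A'} → A ≅ A' → Simulates (∀' A) (∀' A')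
simulates-∀ e (pull-∀ _) = _ , pull-∀ _ , e

≅-bisimulates : ∀ {T T'} → T ≅ T' → Bisimulates T T'
≅-bisimulates (comm A B) =
    (λ { (pull-∧ p q) → _ , pull-∧ q p , comm _ _ })
  , (λ { (pull-∧ p q) → _ , pull-∧ q p , comm _ _ })
≅-bisimulates (assoc A B C) =
    (λ { (pull-∧ p (pull-∧ q r)) → _ , pull-∧ (pull-∧ p q) r , assoc _ _ _ })
  , (λ { (pull-∧ (pull-∧ p q) r) → _ , pull-∧ p (pull-∧ q r) , sym' (assoc _ _ _) })
≅-bisimulates (distrib A B C) =
    (λ { (pull-⇒ _ (pull-∧ p q)) → _ , pull-∧ (pull-⇒ A p) (pull-⇒ A q) , distrib _ _ _ })
  , (λ { (pull-∧ (pull-⇒ _ p) (pull-⇒ _ q)) → _ , pull-⇒ A (pull-∧ p q) , sym' (distrib _ _ _) })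
≅-bisimulates (curry A B C) =
    (λ { (pull-⇒ _ p) → _ , pull-⇒ A (pull-⇒ B p) , curry _ _ _ })
  , (λ { (pull-⇒ _ (pull-⇒ _ p)) → _ , pull-⇒ (A ∧ B) p , sym' (curry _ _ _) })
≅-bisimulates (p-split A B) =
    (λ { (pull-∀ _) → _ , pull-⇒ A (pull-∀ B) , refl' _ })
  , (λ { (pull-⇒ _ (pull-∀ _)) → _ , pull-∀ _ , refl' _ })
≅-bisimulates (p-dist A B) =
    (λ { (pull-∀ _) → _ , pull-∧ (pull-∀ A) (pull-∀ B) , refl' _ })
  , (λ { (pull-∧ (pull-∀ _) (pull-∀ _)) → _ , pull-∀ _ , refl' _ })
≅-bisimulates (refl' A)    = simulates-refl , simulates-refl
≅-bisimulates (sym' e)     = swap (≅-bisimulates e)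
≅-bisimulates (trans' e e') with ≅-bisimulates e | ≅-bisimulates e'
... | f , g | f' , g' = simulates-trans f f' , simulates-trans g' g
≅-bisimulates (cong⇒ eA eB) with ≅-bisimulates eB
... | f , g = simulates-⇒ eA f , simulates-⇒ (sym' eA) g
≅-bisimulates (cong∧ eB eC) with ≅-bisimulates eB | ≅-bisimulates eC
... | f , g | f' , g' = simulates-∧ f f' , simulates-∧ g g'
≅-bisimulates (cong∀ e)    = simulates-∀ e , simulates-∀ (sym' e)

mainTheorem8 : (A B C : Ty) → ∀' A ≅ B ∧ C →
    Σ[ B' ∈ Ty ] Σ[ C' ∈ Ty ] ((B ≅ ∀' B') × (C ≅ ∀' C') × (A ≅ B' ∧ C'))
mainTheorem8 A B C e with proj₁ (≅-bisimulates e) (pull-∀ A)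
... | _ , pull-∧ pB pC , eA = _ , _ , ⇝∀-sound pB , ⇝∀-sound pC , eA
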